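{- Let $\mathcal G=\langle G,h,g\rangle$ be a hat guessing game on a finite directed graph $G$. Let $V(G)=S\cup T$ be a partition of the vertex set such that there is no directed edge $\vec{ts}$ with $t\in T$ and $s\in S$. Then $\mathcal G$ is winning if and only if at least one of the games $\mathcal G[S]$ or $\mathcal G[T]$ is winning.
   Context: Hat guessing game $\langle G,h,g\rangle$ on a directed graph $G$ with $h,g\colon V(G)\to\mathbb N$. A directed edge $\vec{uv}$ means that $u$ sees $v$. The adversary gives each vertex $v$ a color in $\{0,\dots,h(v)-1\}$. Each vertex $u$ sees only the colors of the vertices $v$ with $\vec{uv}\in E(G)$, and names at most $g(u)$ colors via a deterministic strategy fixed in advance that depends only on those colors. The game is winning if some strategy ensures that for every assignment some vertex names its own color. For $X\subseteq V(G)$, $\mathcal G[X]=\langle G[X],h|_X,g|_X\rangle$, where $G[X]$ is the induced subgraph. -}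

module Defs where

open import Data.Nat using (ℕ; _≤_)
open import Data.Fin using (Fin)
open import Data.Bool using (Bool; true; false)
open import Data.List using (List; length)
open import Data.List.Membership.Propositional using (_∈_)
open import Data.Product using (Σ; ∃; _×_; proj₁; _,_)
open import Relation.Binary.PropositionalEquality using (_≡_)

-- A hat guessing game ⟨G,h,g⟩ on a directed graph G with vertex type V.
-- E u v means there is a directed edge u→v, i.e. u sees v.
record Game : Set₁ where
  field
    V : Set
    E : V → V → Set
    h : V → ℕ
    g : V → ℕ

open Game public

Coloring : Game → Set
Coloring G = (v : V G) → Fin (h G v)

Strategy : Game → Set
Strategy G = (u : V G) → Coloring G → List (Fin (h G u))

BoundedGuesses : (G : Game) → Strategy G → Set
BoundedGuesses G σ = ∀ u c → length (σ u c) ≤ g G u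

Local : (G : Game) → Strategy G → Set
Local G σ = ∀ u (c c′ : Coloring G) →
  (∀ v → E G u v → c v ≡ c′ v) → σ u c ≡ σ u c′

Winning : Game → Set
Winning G = Σ (Strategy G) λ σ →
  BoundedGuesses G σ × Local G σ × (∀ (c : Coloring G) → ∃ λ u → c u ∈ σ u c)

digraphGame : (n : ℕ) → (Fin n → Fin n → Bool) → (Fin n → ℕ) → (Fin n → ℕ) → Game
digraphGame n A hh gg = record
  { V = Fin n ; E = λ u v → A u v ≡ true ; h = hh ; g = gg }

induced : (G : Game) → (V G → Bool) → Game
induced G X = record
  { V = Σ (V G) (λ v → X v ≡ true)
  ; E = λ u v → E G (proj₁ u) (proj₁ v)
  ; h = λ v → h G (proj₁ v)
  ; g = λ v → g G (proj₁ v) }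

compl : {A : Set} → (A → Bool) → A → Bool
compl X a with X a
... | true = false
... | false = true

-- Suppose σ wins 𝒢 and call a colouring d of T "forcing" if, with T coloured by d, every
-- colouring of S makes some vertex of S guess correctly. If some d is forcing, the vertices
-- of S win 𝒢[S] by playing σ as if T were coloured by d. Otherwise, for every colouring of T
-- the adversary can colour S so that S guesses wrong everywhere; then a vertex of T guesses
-- correctly, and since T does not see S its guess is the one σ makes for any colouring of S,
-- so T wins 𝒢[T] by playing σ against a fixed colouring of S. (If some vertex has no
-- colours, the side containing it wins vacuously.) Over a finite digraph the existence of a
-- forcing colouring is decidable by exhaustive search, which makes the case split
-- constructive.
module Submission where

open import Defs
open import Data.Nat using (ℕ; zero; suc; _≤_; z≤n)
open import Data.Fin using (Fin; zero; suc)
import Data.Fin as Fin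
open import Data.Fin.Properties using (any?; ¬Fin0; ∀-cons)
open import Data.Bool using (Bool; true; false)
import Data.Bool as Bool
open import Data.Sum using (_⊎_; inj₁; inj₂; [_,_]′; swap)
open import Data.Product using (∃; _×_; _,_; proj₁; proj₂)
open import Data.List using ([]; length)
open import Data.List.Membership.Propositional using (_∈_)
import Data.List.Membership.DecPropositional as DecMembership
open import Data.Empty using (⊥-elim)
open import Relation.Nullary using (¬_; Dec)
open import Relation.Nullary.Decidable using (_×-dec_; toSum)
open import Function.Bundles using (_⇔_; mk⇔)
open import Relation.Binary.PropositionalEquality
  using (_≡_; refl; sym; trans; subst; subst₂)

ifᵈ_then_else_ : {A : Set} (b : Bool) → (b ≡ true → A) → (b ≡ false → A) → A
ifᵈ true  then f else k = f refl
ifᵈ false then f else k = k refl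

ifᵈ-true : {A : Set} {b : Bool} {f : b ≡ true → A} {k : b ≡ false → A} (p : b ≡ true) →
  ifᵈ b then f else k ≡ f p
ifᵈ-true refl = refl

ifᵈ-false : {A : Set} {b : Bool} {f : b ≡ true → A} {k : b ≡ false → A} (p : b ≡ false) →
  ifᵈ b then f else k ≡ k p
ifᵈ-false refl = refl

ifᵈ-elim : {A : Set} (P : A → Set) {b : Bool} {f : b ≡ true → A} {k : b ≡ false → A} →
  (∀ p → P (f p)) → (∀ p → P (k p)) → P (ifᵈ b then f else k)
ifᵈ-elim P {true}  Pf Pk = Pf refl
ifᵈ-elim P {false} Pf Pk = Pk refl

ifᵈ-cong : {A : Set} {b : Bool} {f f′ : b ≡ true → A} {k k′ : b ≡ false → A} →
  (∀ p → f p ≡ f′ p) → (∀ p → k p ≡ k′ p) →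
  ifᵈ b then f else k ≡ ifᵈ b then f′ else k′
ifᵈ-cong {b = true}  ef ek = ef refl
ifᵈ-cong {b = false} ef ek = ek refl

Fin-∀⊎∃ : ∀ m {A B : Fin m → Set} → (∀ i → A i ⊎ B i) → (∀ i → A i) ⊎ ∃ B
Fin-∀⊎∃ zero    choice = inj₁ λ ()
Fin-∀⊎∃ (suc m) choice with choice zero | Fin-∀⊎∃ m (λ i → choice (suc i))
... | inj₂ b | _            = inj₂ (zero , b)
... | inj₁ _ | inj₂ (i , b) = inj₂ (suc i , b)
... | inj₁ a | inj₁ as      = inj₁ (∀-cons a as)

Π-∀⊎∃ : ∀ m (k : Fin m → ℕ) {A B : ((i : Fin m) → Fin (k i)) → Set} →
  (∀ c c′ → (∀ i → c i ≡ c′ i) → A c → A c′) →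
  (∀ c → A c ⊎ B c) → (∀ c → A c) ⊎ ∃ B
Π-∀⊎∃ zero k resp choice =
  [ (λ a → inj₁ λ c → resp _ c (λ ()) a) , (λ b → inj₂ (_ , b)) ]′ (choice (λ ()))
Π-∀⊎∃ (suc m) k resp choice
  with Fin-∀⊎∃ (k zero) (λ a →
         Π-∀⊎∃ m (λ i → k (suc i))
           (λ c c′ c≗c′ → resp (∀-cons a c) (∀-cons a c′) λ { zero → refl ; (suc i) → c≗c′ i })
           (λ c → choice (∀-cons a c)))
... | inj₂ (_ , _ , b) = inj₂ (_ , b)
... | inj₁ all = inj₁ λ c →
  resp _ c (λ { zero → refl ; (suc i) → refl }) (all (c zero) (λ i → c (suc i)))

Π-inhabited⊎∃-empty : ∀ m (k : Fin m → ℕ) → ((i : Fin m) → Fin (k i)) ⊎ ∃ λ i → k i ≡ 0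
Π-inhabited⊎∃-empty m k = Fin-∀⊎∃ m λ i → inhabited⊎zero (k i)
  where
  inhabited⊎zero : ∀ l → Fin l ⊎ l ≡ 0
  inhabited⊎zero zero    = inj₂ refl
  inhabited⊎zero (suc l) = inj₁ zero

compl≡true : {A : Set} (X : A → Bool) {a : A} → X a ≡ false → compl X a ≡ true
compl≡true X {a} p rewrite p = refl

module _ (G : Game) where

  uncolourable⇒winning : (v : V G) → h G v ≡ 0 → Winning G
  uncolourable⇒winning v hv≡0 =
    (λ _ _ → []) , (λ _ _ → z≤n) , (λ _ _ _ _ → refl) ,
    λ c → ⊥-elim (¬Fin0 (subst Fin hv≡0 (c v)))

  CorrectGuessIn : Strategy G → (V G → Bool) → Coloring G → Set
  CorrectGuessIn σ X c = ∃ λ u → X u ≡ true × c u ∈ σ u c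

  correctGuessIn-cong : {σ : Strategy G} → Local G σ → (X : V G → Bool) →
    (c c′ : Coloring G) → (∀ v → c v ≡ c′ v) →
    CorrectGuessIn σ X c → CorrectGuessIn σ X c′
  correctGuessIn-cong local X c c′ c≗c′ (u , Xu , guessed) =
    u , Xu , subst₂ _∈_ (c≗c′ u) (local u c c′ (λ v _ → c≗c′ v)) guessed

module _ (G : Game) (X : V G → Bool) where

  restrict : Coloring G → Coloring (induced G X)
  restrict c v = c (proj₁ v)

  -- Opaque so that the colourings in  override cX d v  can be inferred by unification.
  opaque
    override : Coloring (induced G X) → Coloring G → Coloring G
    override cX d v = ifᵈ X v then (λ p → cX (v , p)) else (λ _ → d v)

  opaque
    unfolding override

    override-in : ∀ {cX d v} (p : X v ≡ true) → override cX d v ≡ cX (v , p)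
    override-in = ifᵈ-true

    override-out : ∀ {cX d v} → X v ≡ false → override cX d v ≡ d v
    override-out = ifᵈ-false

    override-cong : ∀ {cX cX′ d d′} v → (∀ p → cX (v , p) ≡ cX′ (v , p)) → d v ≡ d′ v →
      override cX d v ≡ override cX′ d′ v
    override-cong v cXv≡cX′v dv≡d′v = ifᵈ-cong cXv≡cX′v (λ _ → dv≡d′v)

  liftStrategy : Strategy (induced G X) → Strategy G
  liftStrategy τ u c = ifᵈ X u then (λ p → τ (u , p) (restrict c)) else (λ _ → [])

  induced-winning⇒winning : Winning (induced G X) → Winning G
  induced-winning⇒winning (τ , bounded , local , wins) =
    liftStrategy τ , lift-bounded , lift-local , lift-wins
    where
    lift-bounded : BoundedGuesses G (liftStrategy τ)
    lift-bounded u c = ifᵈ-elim (λ guesses → length guesses ≤ g G u)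
      (λ p → bounded (u , p) (restrict c)) (λ _ → z≤n)

    lift-local : Local G (liftStrategy τ)
    lift-local u c c′ agree = ifᵈ-cong
      (λ p → local (u , p) (restrict c) (restrict c′) (λ v → agree (proj₁ v)))
      (λ _ → refl)

    lift-wins : ∀ c → ∃ λ u → c u ∈ liftStrategy τ u c
    lift-wins c with wins (restrict c)
    ... | (u , p) , guessed = u , subst (c u ∈_) (sym (ifᵈ-true p)) guessed

module _ (G : Game) (σ : Strategy G) where

  Forcing : (V G → Bool) → Coloring G → Set
  Forcing X d = ∀ e → CorrectGuessIn G σ X (override G X (restrict G X e) d)

  Evadable : (V G → Bool) → Coloring G → Set
  Evadable X d = ∃ λ e → ¬ CorrectGuessIn G σ X (override G X (restrict G X e) d)

module _ (G : Game) {σ : Strategy G} (bounded : BoundedGuesses G σ) (local : Local G σ) where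

  fixOutside : (X : V G → Bool) → Coloring G → Strategy (induced G X)
  fixOutside X d u cX = σ (proj₁ u) (override G X cX d)

  fixOutside-bounded : ∀ X d → BoundedGuesses (induced G X) (fixOutside X d)
  fixOutside-bounded X d u cX = bounded (proj₁ u) (override G X cX d)

  fixOutside-local : ∀ X d → Local (induced G X) (fixOutside X d)
  fixOutside-local X d u cX cX′ agree =
    local (proj₁ u) (override G X cX d) (override G X cX′ d)
      λ v uv → override-cong G X v (λ p → agree (v , p) uv) refl

  forcing⇒induced-winning : ∀ X d → Forcing G σ X d → Winning (induced G X)
  forcing⇒induced-winning X d forcing =
    fixOutside X d , fixOutside-bounded X d , fixOutside-local X d , wins
    where
    wins : ∀ cX → ∃ λ u → cX u ∈ fixOutside X d u cX
    wins cX with forcing (override G X cX d)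
    ... | u , p , guessed =
      (u , p) , subst₂ _∈_ (trans (merged≗ u) (override-in G X p))
                          (local u _ _ (λ v _ → merged≗ v)) guessed
      where
      merged≗ : ∀ v → override G X (restrict G X (override G X cX d)) d v ≡ override G X cX d v
      merged≗ v = override-cong G X v (override-in G X) refl

  evadable⇒compl-winning : ∀ X → (∀ {u v} → X u ≡ false → E G u v → X v ≡ false) →
    (∀ c → ∃ λ u → c u ∈ σ u c) → Coloring G → (∀ d → Evadable G σ X d) →
    Winning (induced G (compl X))
  evadable⇒compl-winning X outside-closed wins d₀ evadable =
    fixOutside (compl X) d₀ , fixOutside-bounded (compl X) d₀ ,
    fixOutside-local (compl X) d₀ , winsT
    where
    winsT : ∀ cT → ∃ λ u → cT u ∈ fixOutside (compl X) d₀ u cT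
    winsT cT = ifᵈ X u
      then (λ Xu → ⊥-elim (missesX (u , Xu , guessed)))
      else λ Xu → (u , compl≡true X Xu) ,
        subst₂ _∈_ (trans (override-out G X Xu) (override-in G (compl X) (compl≡true X Xu)))
          (local u c d λ v uv → override-out G X (outside-closed Xu uv)) guessed
      where
      d : Coloring G
      d = override G (compl X) cT d₀

      e : Coloring G
      e = proj₁ (evadable d)

      c : Coloring G
      c = override G X (restrict G X e) d

      missesX : ¬ CorrectGuessIn G σ X c
      missesX = proj₂ (evadable d)

      u : V G
      u = proj₁ (wins c)

      guessed : c u ∈ σ u c
      guessed = proj₂ (wins c)

module _ {n : ℕ} {A : Fin n → Fin n → Bool} {h g : Fin n → ℕ} where

  private
    G : Game
    G = digraphGame n A h g

  correctGuessIn? : (σ : Strategy G) (X : Fin n → Bool) (c : Coloring G) →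
    Dec (CorrectGuessIn G σ X c)
  correctGuessIn? σ X c =
    any? λ u → (X u Bool.≟ true) ×-dec DecMembership._∈?_ Fin._≟_ (c u) (σ u c)

  forcing-dichotomy : {σ : Strategy G} → Local G σ → (X : Fin n → Bool) →
    (∀ d → Evadable G σ X d) ⊎ ∃ (Forcing G σ X)
  forcing-dichotomy {σ} local X =
    Π-∀⊎∃ n h evadable-resp λ d →
      swap (Π-∀⊎∃ n h (guessed-resp d) λ e → toSum (correctGuessIn? σ X (merge d e)))
    where
    merge : Coloring G → Coloring G → Coloring G
    merge d e = override G X (restrict G X e) d

    guessed-resp : ∀ d e e′ → (∀ v → e v ≡ e′ v) →
      CorrectGuessIn G σ X (merge d e) → CorrectGuessIn G σ X (merge d e′)
    guessed-resp d e e′ e≗e′ = correctGuessIn-cong G local X _ _ λ v →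
      override-cong G X v (λ _ → e≗e′ v) refl

    evadable-resp : ∀ d d′ → (∀ v → d v ≡ d′ v) → Evadable G σ X d → Evadable G σ X d′
    evadable-resp d d′ d≗d′ (e , misses) = e , λ guessed → misses
      (correctGuessIn-cong G local X _ _ (λ v → override-cong G X v (λ _ → refl) (sym (d≗d′ v)))
        guessed)

lemma2p6 : (n : ℕ) (A : Fin n → Fin n → Bool) (h g : Fin n → ℕ)
    (S : Fin n → Bool) →
    (∀ t s → S t ≡ false → S s ≡ true → A t s ≡ false) →
    Winning (digraphGame n A h g) ⇔
      (Winning (induced (digraphGame n A h g) S)
        ⊎ Winning (induced (digraphGame n A h g) (compl S)))
lemma2p6 n A h g S noEdgeTS =
  mk⇔ split [ induced-winning⇒winning G S , induced-winning⇒winning G (compl S) ]′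
  where
  G : Game
  G = digraphGame n A h g

  outside-closed : ∀ {u v} → S u ≡ false → A u v ≡ true → S v ≡ false
  outside-closed {u} {v} Su uv with S v in Sv
  ... | false = refl
  ... | true  with () ← trans (sym uv) (noEdgeTS u v Su Sv)

  split : Winning G → Winning (induced G S) ⊎ Winning (induced G (compl S))
  split (σ , bounded , local , wins) with Π-inhabited⊎∃-empty n h
  ... | inj₂ (v , hv≡0) = ifᵈ S v
    then (λ Sv → inj₁ (uncolourable⇒winning (induced G S) (v , Sv) hv≡0))
    else (λ Sv →
      inj₂ (uncolourable⇒winning (induced G (compl S)) (v , compl≡true S Sv) hv≡0))
  ... | inj₁ d₀ with forcing-dichotomy local S
  ...   | inj₁ evadable =
    inj₂ (evadable⇒compl-winning G bounded local S outside-closed wins d₀ evadable)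
  ...   | inj₂ (d , forcing) =
    inj₁ (forcing⇒induced-winning G bounded local S d forcing)
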